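{- The number of accessed elements greater than~$s_i$ which are stubborn is at most $$1+2\lfloor\lg W\rfloor -2r(s_i,i-1).$$
   Context: Consider a sequence $S=\langle s_1,\dots,s_m\rangle$ of successful searches on elements $\{1,\dots,n\}$ with geometric view $X=\{(s_1,1),\dots,(s_m,m)\}$. The online algorithm GreedyASS (geometric view of GreedyFuture) outputs, at each time $i$, the minimal set $P_i$ of points on line $y=i$ needed so that $X\cup P_1\cup\dots\cup P_i$ is arborally satisfied up to $y\le i$ (a pair of points is arborally satisfied if they are horizontally or vertically aligned or their closed axis-aligned rectangle contains another point of the set). It accesses $x$ at time $i$ if $(x,i)\in X\cup P_i$. Let $\rho(x,i)$ be the last access time of $x$ at or before $i$. Let $a$ be the greatest positive integer smaller than $x$ with $\rho(a,i)\ge\rho(x,i)$ (or $a=0$); $\Gamma_\ell(x,i)=\{a+1,\dots,x-1\}$; $\Gamma_r(x,i)$ is defined symmetrically; $\Gamma(x,i)=\Gamma_\ell(x,i)\cup\Gamma_r(x,i)\cup\{x\}$. Each element has positive weight $w(x)$, $W=\sum_{x\in[n]}w(x)$, size $\sigma(x,i)=\sum_{e\in\Gamma(x,i)}w(e)$, rank $r(x,i)=\lfloor\lg\sigma(x,i)\rfloor$. For an element $x>s_i$ accessed at time $i$, its successor $x_r$ is the least element greater than $x$ accessed at time $i$ (if it exists). An accessed element $x>s_i$ is stubborn if it has a successor $x_r$ and $r(x,i)=r(x_r,i-1)$.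
   Formalization: The element weights $w(x)$ are positive rationals rather than positive reals. -}

module Defs where

open import Data.Nat as ℕ using (ℕ; zero; suc; _∸_; _≤ᵇ_; _≡ᵇ_)
open import Data.Bool using (Bool; true; false; if_then_else_; _∨_)
open import Data.Integer as ℤ using (ℤ; +_; -[1+_])
open import Data.Rational as ℚ using (ℚ; 0ℚ; 1ℚ)
open import Data.List using (List; []; _∷_; foldr; map; applyUpTo)
open import Data.Product using (Σ; _×_; ∃; ∃-syntax)
open import Data.Sum using (_⊎_)
open import Relation.Binary.PropositionalEquality using (_≡_; _≢_)

PointSet : Set₁
PointSet = ℕ → ℕ → Set

ArborallySatisfied : PointSet → Set
ArborallySatisfied Z =
  ∀ x₁ y₁ x₂ y₂ → Z x₁ y₁ → Z x₂ y₂ →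
    x₁ ≡ x₂ ⊎ y₁ ≡ y₂ ⊎
    (∃[ x₃ ] ∃[ y₃ ] Z x₃ y₃
       × ¬pt x₃ y₃ x₁ y₁ × ¬pt x₃ y₃ x₂ y₂
       × ℕ._≤_ (x₁ ℕ.⊓ x₂) x₃ × ℕ._≤_ x₃ (x₁ ℕ.⊔ x₂)
       × ℕ._≤_ (y₁ ℕ.⊓ y₂) y₃ × ℕ._≤_ y₃ (y₁ ℕ.⊔ y₂))
  where
  ¬pt : ℕ → ℕ → ℕ → ℕ → Set
  ¬pt a b c d = (a ≡ c × b ≡ d) → Data.Empty.⊥
    where import Data.Empty

-- Search sequence s (s j is the key searched at time j, times 1..m) and
-- added points R (R j x = true iff (x , j) ∈ P_j).  The point set
-- X ∪ P_1 ∪ … ∪ P_i restricted to rows 1 ≤ y ≤ i: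
PointsUpTo : (ℕ → ℕ) → (ℕ → ℕ → Bool) → ℕ → PointSet
PointsUpTo s R i x y = ℕ._≤_ 1 y × ℕ._≤_ y i × (x ≡ s y ⊎ R y x ≡ true)

replaceRow : (ℕ → ℕ → Bool) → ℕ → (ℕ → Bool) → ℕ → ℕ → Bool
replaceRow R i Q j x = if j ≡ᵇ i then Q x else R j x

-- P is the output of GreedyASS on s (elements 1..n, times 1..m):
-- for every time i, P_i is a set of points on the line y = i (with keys
-- in 1..n) such that X ∪ P_1 ∪ … ∪ P_i is arborally satisfied up to
-- y ≤ i, and P_i is minimal: no proper subset of P_i achieves this.
IsGreedyASS : ℕ → ℕ → (ℕ → ℕ) → (ℕ → ℕ → Bool) → Set
IsGreedyASS n m s P =
  ∀ i → ℕ._≤_ 1 i → ℕ._≤_ i m →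
    (∀ x → P i x ≡ true → ℕ._≤_ 1 x × ℕ._≤_ x n)
  × ArborallySatisfied (PointsUpTo s P i)
  × (∀ (Q : ℕ → Bool) → (∀ x → Q x ≡ true → P i x ≡ true)
       → (∃[ x ] P i x ≡ true × Q x ≡ false)
       → ArborallySatisfied (PointsUpTo s (replaceRow P i Q) i)
       → Data.Empty.⊥)
  where import Data.Empty

pow2 : ℕ → ℚ
pow2 k = + (2 ℕ.^ k) ℚ./ 1

FloorLg : ℚ → ℤ → Set
FloorLg q (+ k)     = pow2 k ℚ.≤ q × q ℚ.< pow2 (suc k)
-- k = -(j+1):  2^-(j+1) ≤ q < 2^-j
FloorLg q -[1+ j ]  = 1ℚ ℚ.≤ q ℚ.* pow2 (suc j) × q ℚ.* pow2 j ℚ.< 1ℚ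

sumℚ : List ℚ → ℚ
sumℚ = foldr ℚ._+_ 0ℚ

module Model (n : ℕ) (s : ℕ → ℕ) (P : ℕ → ℕ → Bool) (w : ℕ → ℚ) where

  acc : ℕ → ℕ → Bool
  acc j x = (s j ≡ᵇ x) ∨ P j x

  -- ρ x i : last access time of x at or before i (0 if none)
  ρ : ℕ → ℕ → ℕ
  ρ x zero    = zero
  ρ x (suc i) = if acc (suc i) x then suc i else ρ x i

  leftSearch : ℕ → ℕ → ℕ → ℕ
  leftSearch t i zero    = zero
  leftSearch t i (suc a) = if t ≤ᵇ ρ (suc a) i then suc a else leftSearch t i a

  rightSearch : ℕ → ℕ → ℕ → ℕ → ℕ
  rightSearch t i zero    y = suc n
  rightSearch t i (suc k) y = if t ≤ᵇ ρ y i then y else rightSearch t i k (suc y)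

  leftEnd : ℕ → ℕ → ℕ
  leftEnd x i = leftSearch (ρ x i) i (x ∸ 1)

  rightEnd : ℕ → ℕ → ℕ
  rightEnd x i = rightSearch (ρ x i) i (n ∸ x) (suc x)

  -- Γ(x,i) = {a+1, …, b-1} = Γℓ ∪ {x} ∪ Γr ; size σ(x,i)
  σ : ℕ → ℕ → ℚ
  σ x i = sumℚ (applyUpTo (λ k → w (suc (leftEnd x i) ℕ.+ k))
                           (rightEnd x i ∸ suc (leftEnd x i)))

  W : ℚ
  W = sumℚ (applyUpTo (λ k → w (suc k)) n)

  IsSuccessor : ℕ → ℕ → ℕ → Set
  IsSuccessor i x y =
    ℕ._<_ x y × acc i y ≡ true
    × (∀ z → ℕ._<_ x z → ℕ._<_ z y → acc i z ≡ false)

  Stubborn : ℕ → ℕ → Set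
  Stubborn i x =
    acc i x ≡ true × ℕ._<_ (s i) x
    × (∃[ y ] IsSuccessor i x y
         × (∃[ k ] FloorLg (σ x i) k × FloorLg (σ y (i ∸ 1)) k))

module Submission where

-- Write Γ(x, t) = (a, b) and t = i - 1.  The argument has three ingredients.
-- (1) Staircase: if y > s_i is accessed at time i, every z ∈ [s_i, y) was
--     last accessed before y; otherwise deleting the offending points of
--     row i keeps X ∪ P_1 ∪ … ∪ P_i arborally satisfied, contradicting the
--     minimality of P_i.  Hence Γ(s_i, t) ⊆ Γ(y, t), and Γ(x, i) ⊆ (s_i, y)
--     when y is the successor of x.
-- (2) Ranks: σ(s_i, t) ≤ σ(y, t) ≤ W bounds every stubborn rank by rs and
--     lgW; since two disjoint intervals of the same rank as an enclosing one
--     cannot both fit, a rank equals rs only for the leftmost stubborn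
--     element and no rank occurs at positions x < x' < x'' at both ends.
-- (3) Counting: positions with ranks in [0, D] under these two constraints
--     number at most 2D + 1 (an injective code into [0, 2D] and pigeonhole).
-- The file develops ⌊lg⌋ arithmetic, interval weights, the counting lemma,
-- the access model, the staircase property, and then assembles lemma4.

open import Defs
open import Data.Nat as ℕ using (ℕ; zero; suc; _∸_; _≤_; _<_; _≤ᵇ_; _<ᵇ_; _≡ᵇ_; _⊓_; _⊔_; z≤n; s≤s)
import Data.Nat.Properties as ℕP
open import Data.Bool using (Bool; true; false; _∧_; _∨_; if_then_else_)
open import Data.Bool.Properties using (∨-zeroʳ; ¬-not)
open import Data.Integer as ℤ using (ℤ; +_; -[1+_])
import Data.Integer.Properties as ℤP
open import Data.Integer.Tactic.RingSolver using (solve-∀)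
open import Data.Rational as ℚ using (ℚ; 0ℚ)
import Data.Rational.Properties as ℚP
open import Data.Rational.Unnormalised as ℚᵘ using (mkℚᵘ) renaming (_≃_ to _≃ᵘ_)
import Data.Rational.Unnormalised.Properties as ℚᵘP
open import Data.List using (List; []; _∷_; length; map; applyUpTo)
open import Data.List.Properties using (length-map; map-id)
open import Data.List.Relation.Unary.All as All using (All; []; _∷_)
open import Data.List.Relation.Unary.All.Properties using (map⁺; map⁻)
open import Data.List.Relation.Unary.Any as Any using (Any; here; there; any?)
open import Data.List.Relation.Unary.AllPairs using ([]; _∷_)
open import Data.List.Relation.Unary.Unique.Propositional using (Unique)
open import Data.List.Membership.Propositional using (_∈_; find)
open import Data.Product using (Σ; ∃-syntax; _×_; _,_; proj₁; proj₂)
open import Data.Sum using (_⊎_; inj₁; inj₂)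
open import Data.Empty using (⊥-elim)
open import Function using (_∘_)
open import Relation.Nullary using (¬_; Dec; yes; no; contradiction)
open import Relation.Nullary.Decidable using (_×-dec_)
open import Relation.Nullary.Reflects using (Reflects; ofʸ; ofⁿ; invert; det; fromEquivalence)
open import Relation.Binary.Definitions using (tri<; tri≈; tri>)
open import Relation.Binary.PropositionalEquality

ι : ℕ → ℚ
ι m = + m ℚ./ 1

ι-toℚᵘ : ∀ m → ℚ.toℚᵘ (ι m) ≃ᵘ mkℚᵘ (+ m) 0
ι-toℚᵘ m = ℚP.toℚᵘ-fromℚᵘ (mkℚᵘ (+ m) 0)

ι-+ : ∀ a b → ι a ℚ.+ ι b ≡ ι (a ℕ.+ b)
ι-+ a b = ℚP.toℚᵘ-injective (begin
  ℚ.toℚᵘ (ι a ℚ.+ ι b)                 ≈⟨ ℚP.toℚᵘ-homo-+ (ι a) (ι b) ⟩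
  ℚ.toℚᵘ (ι a) ℚᵘ.+ ℚ.toℚᵘ (ι b)        ≈⟨ ℚᵘP.+-cong (ι-toℚᵘ a) (ι-toℚᵘ b) ⟩
  mkℚᵘ (+ a) 0 ℚᵘ.+ mkℚᵘ (+ b) 0        ≈⟨ ℚᵘ.*≡* (cong (ℤ._* + 1) numerator) ⟩
  mkℚᵘ (+ (a ℕ.+ b)) 0                  ≈⟨ ℚᵘP.≃-sym (ι-toℚᵘ (a ℕ.+ b)) ⟩
  ℚ.toℚᵘ (ι (a ℕ.+ b))                  ∎)
  where
  open ℚᵘP.≃-Reasoning
  numerator : + a ℤ.* + 1 ℤ.+ + b ℤ.* + 1 ≡ + (a ℕ.+ b)
  numerator rewrite ℤP.*-identityʳ (+ a) | ℤP.*-identityʳ (+ b) = sym (ℤP.pos-+ a b)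

ι-* : ∀ a b → ι a ℚ.* ι b ≡ ι (a ℕ.* b)
ι-* a b = ℚP.toℚᵘ-injective (begin
  ℚ.toℚᵘ (ι a ℚ.* ι b)                 ≈⟨ ℚP.toℚᵘ-homo-* (ι a) (ι b) ⟩
  ℚ.toℚᵘ (ι a) ℚᵘ.* ℚ.toℚᵘ (ι b)        ≈⟨ ℚᵘP.*-cong (ι-toℚᵘ a) (ι-toℚᵘ b) ⟩
  mkℚᵘ (+ a) 0 ℚᵘ.* mkℚᵘ (+ b) 0        ≈⟨ ℚᵘ.*≡* (cong (ℤ._* + 1) (sym (ℤP.pos-* a b))) ⟩
  mkℚᵘ (+ (a ℕ.* b)) 0                  ≈⟨ ℚᵘP.≃-sym (ι-toℚᵘ (a ℕ.* b)) ⟩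
  ℚ.toℚᵘ (ι (a ℕ.* b))                  ∎)
  where open ℚᵘP.≃-Reasoning

ι-mono : ∀ {a b} → a ≤ b → ι a ℚ.≤ ι b
ι-mono {a} {b} a≤b = ℚP.toℚᵘ-cancel-≤
  (ℚᵘP.≤-respʳ-≃ (ℚᵘP.≃-sym (ι-toℚᵘ b)) (ℚᵘP.≤-respˡ-≃ (ℚᵘP.≃-sym (ι-toℚᵘ a))
    (ℚᵘ.*≤* (ℤP.*-monoʳ-≤-nonNeg (+ 1) (ℤ.+≤+ a≤b)))))

pow2-+ : ∀ a b → pow2 (a ℕ.+ b) ≡ pow2 a ℚ.* pow2 b
pow2-+ a b rewrite ℕP.^-distribˡ-+-* 2 a b = sym (ι-* (2 ℕ.^ a) (2 ℕ.^ b))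

pow2-double : ∀ e → pow2 (suc e) ≡ pow2 e ℚ.+ pow2 e
pow2-double e rewrite ι-+ (2 ℕ.^ e) (2 ℕ.^ e) | ℕP.+-identityʳ (2 ℕ.^ e) = refl

pow2-mono : ∀ {a b} → a ≤ b → pow2 a ℚ.≤ pow2 b
pow2-mono {a} a≤b = ι-mono (ℕP.^-monoʳ-≤ 2 a≤b)

ℚ-≤⇒≯ : ∀ {p q} → p ℚ.≤ q → ¬ (q ℚ.< p)
ℚ-≤⇒≯ p≤q q<p = ℚP.<-irrefl refl (ℚP.<-≤-trans q<p p≤q)

pow2-cancel-< : ∀ {a b} → pow2 a ℚ.< pow2 b → a < b
pow2-cancel-< {a} {b} lt with ℕP.<-≤-connex a b
... | inj₁ a<b = a<b
... | inj₂ b≤a = contradiction lt (ℚ-≤⇒≯ (pow2-mono b≤a))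

*pow2-mono-≤ : ∀ {p q} M → p ℚ.≤ q → p ℚ.* pow2 M ℚ.≤ q ℚ.* pow2 M
*pow2-mono-≤ M = ℚP.*-monoʳ-≤-nonNeg (pow2 M) {{ℚP.normalize-nonNeg (2 ℕ.^ M) 1}}

*pow2-mono-< : ∀ {p q} M → p ℚ.< q → p ℚ.* pow2 M ℚ.< q ℚ.* pow2 M
*pow2-mono-< M = ℚP.*-monoˡ-<-pos (pow2 M)
  {{ℚP.normalize-pos (2 ℕ.^ M) 1 {{ℕ.nonZero}} {{ℕ.>-nonZero (ℕP.m^n>0 2 M)}}}}

-- Scaling by 2^M moves a rank k ≥ -M into ℕ: 'deficit k' is how far k is
-- below zero and 'offset k M' is the natural number k + M.
deficit : ℤ → ℕ
deficit (+ _)    = 0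
deficit -[1+ j ] = suc j

offset : ℤ → ℕ → ℕ
offset (+ a)    M = a ℕ.+ M
offset -[1+ j ] M = M ∸ suc j

floorLg-scaled : ∀ {q} k M → deficit k ≤ M → FloorLg q k
  → pow2 (offset k M) ℚ.≤ q ℚ.* pow2 M × q ℚ.* pow2 M ℚ.< pow2 (suc (offset k M))
floorLg-scaled {q} (+ a) M _ (lo , hi) =
  subst (ℚ._≤ q ℚ.* pow2 M) (sym (pow2-+ a M)) (*pow2-mono-≤ M lo) ,
  subst (q ℚ.* pow2 M ℚ.<_) (sym (pow2-+ (suc a) M)) (*pow2-mono-< M hi)
floorLg-scaled {q} -[1+ j ] M sj≤M (lo , hi) = lower , upper
  where
  e = M ∸ suc j
  regroup : ∀ d f → d ℕ.+ f ≡ M → q ℚ.* pow2 d ℚ.* pow2 f ≡ q ℚ.* pow2 M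
  regroup d f eq = trans (ℚP.*-assoc q (pow2 d) (pow2 f))
                         (cong (q ℚ.*_) (trans (sym (pow2-+ d f)) (cong pow2 eq)))
  lower : pow2 e ℚ.≤ q ℚ.* pow2 M
  lower = subst₂ ℚ._≤_ (ℚP.*-identityˡ (pow2 e)) (regroup (suc j) e (ℕP.m+[n∸m]≡n sj≤M))
            (*pow2-mono-≤ e lo)
  upper : q ℚ.* pow2 M ℚ.< pow2 (suc e)
  upper = subst₂ ℚ._<_ (regroup j (suc e) (trans (ℕP.+-suc j e) (ℕP.m+[n∸m]≡n sj≤M)))
            (ℚP.*-identityˡ (pow2 (suc e))) (*pow2-mono-< (suc e) hi)

offset-mono : ∀ r R M → r ℤ.≤ R → offset r M ≤ offset R M
offset-mono (+ a)    (+ b)    M (ℤ.+≤+ a≤b) = ℕP.+-monoˡ-≤ M a≤b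
offset-mono -[1+ i ] (+ b)    M ℤ.-≤+       = ℕP.≤-trans (ℕP.m∸n≤m M (suc i)) (ℕP.m≤n+m M b)
offset-mono -[1+ i ] -[1+ j ] M (ℤ.-≤- j≤i) = ℕP.∸-monoʳ-≤ M (s≤s j≤i)

offset-cancel-≤ : ∀ r R M → deficit R ≤ M → offset r M ≤ offset R M → r ℤ.≤ R
offset-cancel-≤ (+ a)    (+ b)    M _    le = ℤ.+≤+ (ℕP.+-cancelʳ-≤ M a b le)
offset-cancel-≤ (+ a)    -[1+ j ] M sj≤M le =
  contradiction (ℕP.≤-trans (ℕP.m≤n+m M a) le) (ℕP.<⇒≱ (ℕP.∸-monoʳ-< ℕ.z<s sj≤M))
offset-cancel-≤ -[1+ i ] (+ b)    M _    le = ℤ.-≤+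
offset-cancel-≤ -[1+ i ] -[1+ j ] M sj≤M le = ℤ.-≤- (ℕP.≤-pred (ℕP.∸-cancelʳ-≤ sj≤M le))

-- A scale large enough for two ranks at once.
common : ℤ → ℤ → ℕ
common r R = deficit r ℕ.+ deficit R

floorLg-mono : ∀ {p q r R} → FloorLg p r → FloorLg q R → p ℚ.≤ q → r ℤ.≤ R
floorLg-mono {p} {q} {r} {R} fp fq p≤q =
  offset-cancel-≤ r R M (ℕP.m≤n+m (deficit R) (deficit r)) (ℕP.m<1+n⇒m≤n (pow2-cancel-<
    (ℚP.≤-<-trans (proj₁ sp) (ℚP.≤-<-trans (*pow2-mono-≤ M p≤q) (proj₂ sq)))))
  where
  M = common r R
  sp = floorLg-scaled r M (ℕP.m≤m+n (deficit r) (deficit R)) fp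
  sq = floorLg-scaled R M (ℕP.m≤n+m (deficit R) (deficit r)) fq

-- If a + b ≤ c where b and c have the same rank B, then a has rank below B:
-- otherwise a and b would both be at least 2^B and c at least 2^(B+1).
floorLg-sum : ∀ {a b c A B} → FloorLg a A → FloorLg b B → FloorLg c B
  → a ℚ.+ b ℚ.≤ c → A ℤ.< B
floorLg-sum {a} {b} {c} {A} {B} fa fb fc a+b≤c with A ℤP.<? B
... | yes A<B = A<B
... | no A≮B = contradiction (proj₂ sc) (ℚ-≤⇒≯ twice)
  where
  M = common A B
  sa = floorLg-scaled A M (ℕP.m≤m+n (deficit A) (deficit B)) fa
  sb = floorLg-scaled B M (ℕP.m≤n+m (deficit B) (deficit A)) fb
  sc = floorLg-scaled B M (ℕP.m≤n+m (deficit B) (deficit A)) fc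
  e = offset B M
  twice : pow2 (suc e) ℚ.≤ c ℚ.* pow2 M
  twice = begin
    pow2 (suc e)                   ≡⟨ pow2-double e ⟩
    pow2 e ℚ.+ pow2 e              ≤⟨ ℚP.+-mono-≤ (ℚP.≤-trans (pow2-mono (offset-mono B A M (ℤP.≮⇒≥ A≮B))) (proj₁ sa)) (proj₁ sb) ⟩
    a ℚ.* pow2 M ℚ.+ b ℚ.* pow2 M  ≡⟨ ℚP.*-distribʳ-+ (pow2 M) a b ⟨
    (a ℚ.+ b) ℚ.* pow2 M           ≤⟨ *pow2-mono-≤ M a+b≤c ⟩
    c ℚ.* pow2 M                   ∎
    where open ℚP.≤-Reasoning

-- Weight of the integer interval [lo, hi).  σ x i is weight (a+1) b for
-- the ends a, b of Γ(x,i), and W is weight 1 (n+1), both definitionally.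
module IntervalWeight (n : ℕ) (w : ℕ → ℚ) (w-pos : ∀ x → 1 ≤ x → x ≤ n → 0ℚ ℚ.< w x) where

  weight : ℕ → ℕ → ℚ
  weight lo hi = sumℚ (applyUpTo (λ k → w (lo ℕ.+ k)) (hi ∸ lo))

  private
    Σ< : (ℕ → ℚ) → ℕ → ℚ
    Σ< f len = sumℚ (applyUpTo f len)

    Σ<-+ : ∀ f a b → Σ< f (a ℕ.+ b) ≡ Σ< f a ℚ.+ Σ< (λ k → f (a ℕ.+ k)) b
    Σ<-+ f zero    b = sym (ℚP.+-identityˡ _)
    Σ<-+ f (suc a) b = trans (cong (f 0 ℚ.+_) (Σ<-+ (f ∘ suc) a b)) (sym (ℚP.+-assoc (f 0) _ _))

    Σ<-cong : ∀ f g len → (∀ k → f k ≡ g k) → Σ< f len ≡ Σ< g len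
    Σ<-cong f g zero      f≗g = refl
    Σ<-cong f g (suc len) f≗g = cong₂ ℚ._+_ (f≗g 0) (Σ<-cong (f ∘ suc) (g ∘ suc) len (f≗g ∘ suc))

    Σ<-nonNeg : ∀ f len → (∀ k → k < len → 0ℚ ℚ.≤ f k) → 0ℚ ℚ.≤ Σ< f len
    Σ<-nonNeg f zero      _  = ℚP.≤-refl
    Σ<-nonNeg f (suc len) f≥0 = subst (ℚ._≤ f 0 ℚ.+ Σ< (f ∘ suc) len) (ℚP.+-identityˡ 0ℚ)
      (ℚP.+-mono-≤ (f≥0 0 ℕ.z<s) (Σ<-nonNeg (f ∘ suc) len (λ k k< → f≥0 (suc k) (s≤s k<))))

  weight-split : ∀ lo mid hi → lo ≤ mid → mid ≤ hi → weight lo hi ≡ weight lo mid ℚ.+ weight mid hi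
  weight-split lo mid hi lo≤mid mid≤hi = begin
    weight lo hi
      ≡⟨ cong (Σ< (λ k → w (lo ℕ.+ k))) length-split ⟩
    Σ< (λ k → w (lo ℕ.+ k)) ((mid ∸ lo) ℕ.+ (hi ∸ mid))
      ≡⟨ Σ<-+ (λ k → w (lo ℕ.+ k)) (mid ∸ lo) (hi ∸ mid) ⟩
    weight lo mid ℚ.+ Σ< (λ k → w (lo ℕ.+ ((mid ∸ lo) ℕ.+ k))) (hi ∸ mid)
      ≡⟨ cong (weight lo mid ℚ.+_) (Σ<-cong _ _ (hi ∸ mid) (λ k → cong w (reindex k))) ⟩
    weight lo mid ℚ.+ weight mid hi ∎
    where
    open ≡-Reasoning
    length-split : hi ∸ lo ≡ (mid ∸ lo) ℕ.+ (hi ∸ mid)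
    length-split = trans (cong (_∸ lo) (sym (ℕP.m∸n+n≡m mid≤hi)))
                   (trans (ℕP.+-∸-assoc (hi ∸ mid) lo≤mid) (ℕP.+-comm (hi ∸ mid) (mid ∸ lo)))
    reindex : ∀ k → lo ℕ.+ ((mid ∸ lo) ℕ.+ k) ≡ mid ℕ.+ k
    reindex k = trans (sym (ℕP.+-assoc lo (mid ∸ lo) k)) (cong (ℕ._+ k) (ℕP.m+[n∸m]≡n lo≤mid))

  weight-nonNeg : ∀ lo hi → 1 ≤ lo → hi ≤ suc n → 0ℚ ℚ.≤ weight lo hi
  weight-nonNeg lo hi 1≤lo hi≤ = Σ<-nonNeg _ (hi ∸ lo) (λ k k< →
    ℚP.<⇒≤ (w-pos (lo ℕ.+ k) (ℕP.≤-trans 1≤lo (ℕP.m≤m+n lo k))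
      (ℕP.≤-pred (ℕP.≤-trans (in-range lo hi k k<) hi≤))))
    where
    in-range : ∀ lo hi k → k < hi ∸ lo → lo ℕ.+ k < hi
    in-range zero     hi       k k< = k<
    in-range (suc lo) (suc hi) k k< = s≤s (in-range lo hi k k<)

  private
    ≤-+-nonNeg : ∀ {x y z} → 0ℚ ℚ.≤ y → 0ℚ ℚ.≤ z → x ℚ.≤ y ℚ.+ (x ℚ.+ z)
    ≤-+-nonNeg {x} {y} {z} y≥0 z≥0 = begin
      x                 ≡⟨ ℚP.+-identityˡ x ⟨
      0ℚ ℚ.+ x          ≤⟨ ℚP.+-monoˡ-≤ x y≥0 ⟩
      y ℚ.+ x           ≡⟨ ℚP.+-identityʳ (y ℚ.+ x) ⟨
      y ℚ.+ x ℚ.+ 0ℚ    ≤⟨ ℚP.+-monoʳ-≤ (y ℚ.+ x) z≥0 ⟩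
      y ℚ.+ x ℚ.+ z     ≡⟨ ℚP.+-assoc y x z ⟩
      y ℚ.+ (x ℚ.+ z)   ∎
      where open ℚP.≤-Reasoning

  weight-mono : ∀ lo' lo hi hi' → 1 ≤ lo' → lo' ≤ lo → lo ≤ hi → hi ≤ hi' → hi' ≤ suc n
    → weight lo hi ℚ.≤ weight lo' hi'
  weight-mono lo' lo hi hi' 1≤lo' lo'≤lo lo≤hi hi≤hi' hi'≤ =
    subst (weight lo hi ℚ.≤_) (sym whole)
      (≤-+-nonNeg (weight-nonNeg lo' lo 1≤lo' (ℕP.≤-trans lo≤hi (ℕP.≤-trans hi≤hi' hi'≤)))
                  (weight-nonNeg hi hi' (ℕP.≤-trans 1≤lo' (ℕP.≤-trans lo'≤lo lo≤hi)) hi'≤))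
    where
    whole : weight lo' hi' ≡ weight lo' lo ℚ.+ (weight lo hi ℚ.+ weight hi hi')
    whole = trans (weight-split lo' lo hi' lo'≤lo (ℕP.≤-trans lo≤hi hi≤hi'))
                  (cong (weight lo' lo ℚ.+_) (weight-split lo hi hi' lo≤hi hi≤hi'))

  weight-disjoint : ∀ lo a b c d hi → 1 ≤ lo → lo ≤ a → a ≤ b → b ≤ c → c ≤ d → d ≤ hi → hi ≤ suc n
    → weight a b ℚ.+ weight c d ℚ.≤ weight lo hi
  weight-disjoint lo a b c d hi 1≤lo lo≤a a≤b b≤c c≤d d≤hi hi≤ =
    subst (weight a b ℚ.+ weight c d ℚ.≤_) (sym (weight-split lo b hi lo≤b b≤hi))
      (ℚP.+-mono-≤ (weight-mono lo a b b 1≤lo lo≤a a≤b ℕP.≤-refl (ℕP.≤-trans b≤hi hi≤))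
                   (weight-mono b c d hi (ℕP.≤-trans 1≤lo lo≤b) b≤c c≤d d≤hi hi≤))
    where
    lo≤b = ℕP.≤-trans lo≤a a≤b
    b≤hi = ℕP.≤-trans b≤c (ℕP.≤-trans c≤d d≤hi)

unique-map-transfer : ∀ {A B C : Set} {f : A → B} {g : A → C} (xs : List A)
  → (∀ {a b} → a ∈ xs → b ∈ xs → g a ≡ g b → f a ≡ f b)
  → Unique (map f xs) → Unique (map g xs)
unique-map-transfer []       _   _              = []
unique-map-transfer (a ∷ xs) inj (fa∉ ∷ unique) =
  map⁺ (All.tabulate λ b∈ ga≡gb → All.lookup (map⁻ fa∉) b∈ (inj (here refl) (there b∈) ga≡gb))
  ∷ unique-map-transfer xs (λ a∈ b∈ → inj (there a∈) (there b∈)) unique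

-- squeeze x closes the gap left by removing x from the naturals.
squeeze : ℕ → ℕ → ℕ
squeeze x z with z ℕP.<? x
... | yes _ = z
... | no  _ = z ∸ 1

private
  ≮∧≢⇒> : ∀ {x z} → ¬ z < x → z ≢ x → x < z
  ≮∧≢⇒> z≮x z≢x = ℕP.≤∧≢⇒< (ℕP.≮⇒≥ z≮x) (λ x≡z → z≢x (sym x≡z))

squeeze-< : ∀ {N x z} → x < suc N → z < suc N → z ≢ x → squeeze x z < N
squeeze-< {N} {x} {z} x≤N z≤N z≢x with z ℕP.<? x
... | yes z<x = ℕP.<-≤-trans z<x (ℕP.≤-pred x≤N)
... | no  z≮x = pred-< (≮∧≢⇒> z≮x z≢x) z≤N
  where
  pred-< : ∀ {x z N} → x < z → z < suc N → z ∸ 1 < N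
  pred-< {z = suc z} _ (s≤s z<N) = z<N

squeeze-injective : ∀ {x a b} → a ≢ x → b ≢ x → squeeze x a ≡ squeeze x b → a ≡ b
squeeze-injective {x} {a} {b} a≢x b≢x eq with a ℕP.<? x | b ℕP.<? x
... | yes _   | yes _   = eq
... | no  a≮x | no  b≮x = ℕP.∸-cancelʳ-≡ (ℕP.≤-<-trans z≤n (≮∧≢⇒> a≮x a≢x)) (ℕP.≤-<-trans z≤n (≮∧≢⇒> b≮x b≢x)) eq
... | yes a<x | no  b≮x = contradiction eq (ℕP.<⇒≢ (ℕP.<-≤-trans a<x (ℕP.∸-monoˡ-≤ 1 (≮∧≢⇒> b≮x b≢x))))
... | no  a≮x | yes b<x = contradiction (sym eq) (ℕP.<⇒≢ (ℕP.<-≤-trans b<x (ℕP.∸-monoˡ-≤ 1 (≮∧≢⇒> a≮x a≢x))))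

unique-bounded-length : ∀ N xs → Unique xs → All (_< N) xs → length xs ≤ N
unique-bounded-length N       []       _            _                = z≤n
unique-bounded-length zero    (x ∷ xs) _            (() ∷ _)
unique-bounded-length (suc N) (x ∷ xs) (x∉ ∷ unique) (x<N ∷ xs<N) =
  s≤s (subst (_≤ N) (length-map (squeeze x) xs) (unique-bounded-length N (map (squeeze x) xs)
    (unique-map-transfer xs (λ a∈ b∈ → squeeze-injective (≢x a∈) (≢x b∈)) (subst Unique (sym (map-id xs)) unique))
    (map⁺ (All.tabulate λ z∈ → squeeze-< x<N (All.lookup xs<N z∈) (≢x z∈)))))
  where
  ≢x : ∀ {z} → z ∈ xs → z ≢ x
  ≢x z∈ z≡x = All.lookup x∉ z∈ (sym z≡x)

double-∸-mono : ∀ {d d' c'} → d < d' → c' ≤ 1 → ∀ c → 2 ℕ.* d ∸ c < 2 ℕ.* d' ∸ c'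
double-∸-mono {d} {d'} {c'} d<d' c'≤1 c = begin-strict
  2 ℕ.* d ∸ c          ≤⟨ ℕP.m∸n≤m (2 ℕ.* d) c ⟩
  2 ℕ.* d              <⟨ ℕP.n<1+n (2 ℕ.* d) ⟩
  2 ℕ.+ 2 ℕ.* d ∸ 1    ≡⟨ cong (_∸ 1) (ℕP.*-suc 2 d) ⟨
  2 ℕ.* suc d ∸ 1      ≤⟨ ℕP.∸-monoˡ-≤ 1 (ℕP.*-monoʳ-≤ 2 d<d') ⟩
  2 ℕ.* d' ∸ 1         ≤⟨ ℕP.∸-monoʳ-≤ (2 ℕ.* d') c'≤1 ⟩
  2 ℕ.* d' ∸ c'        ∎
  where open ℕP.≤-Reasoning

double-∸-injective : ∀ {d d' c c'} → c ≤ 1 → c' ≤ 1 → 2 ℕ.* d ∸ c ≡ 2 ℕ.* d' ∸ c' → d ≡ d'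
double-∸-injective {d} {d'} {c} {c'} c≤1 c'≤1 eq with ℕP.<-cmp d d'
... | tri≈ _ d≡d' _ = d≡d'
... | tri< d<d' _ _ = contradiction eq (ℕP.<⇒≢ (double-∸-mono d<d' c'≤1 c))
... | tri> _ _ d'<d = contradiction (sym eq) (ℕP.<⇒≢ (double-∸-mono d'<d c≤1 c'))

-- Each item a is coded by 2·rank a, minus one if an earlier item shares
-- its rank; the code is injective and below 2D + 1.
module RankCounting {A : Set} (pos rank : A → ℕ) (D : ℕ) (as : List A)
  (rank≤D : ∀ {a} → a ∈ as → rank a ≤ D)
  (no-triple : ∀ {a b c} → a ∈ as → b ∈ as → c ∈ as → pos a < pos b → pos b < pos c → rank a ≢ rank c)
  (later-positive : ∀ {a b} → a ∈ as → b ∈ as → pos a < pos b → 0 < rank b)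
  where

  EarlierTwin : A → Set
  EarlierTwin a = Any (λ b → pos b < pos a × rank b ≡ rank a) as

  earlierTwin? : ∀ a → Dec (EarlierTwin a)
  earlierTwin? a = any? (λ b → (pos b ℕP.<? pos a) ×-dec (rank b ℕP.≟ rank a)) as

  twin : A → ℕ
  twin a with earlierTwin? a
  ... | yes _ = 1
  ... | no  _ = 0

  twin-yes : ∀ {a} → EarlierTwin a → twin a ≡ 1
  twin-yes {a} t with earlierTwin? a
  ... | yes _  = refl
  ... | no  ¬t = contradiction t ¬t

  twin-no : ∀ {a} → ¬ EarlierTwin a → twin a ≡ 0
  twin-no {a} ¬t with earlierTwin? a
  ... | yes t = contradiction t ¬t
  ... | no  _ = refl

  twin≤1 : ∀ a → twin a ≤ 1
  twin≤1 a with earlierTwin? a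
  ... | yes _ = ℕP.≤-refl
  ... | no  _ = z≤n

  code : A → ℕ
  code a = 2 ℕ.* rank a ∸ twin a

  code-< : ∀ {a} → a ∈ as → code a < suc (2 ℕ.* D)
  code-< {a} a∈ = s≤s (ℕP.≤-trans (ℕP.m∸n≤m _ (twin a)) (ℕP.*-monoʳ-≤ 2 (rank≤D a∈)))

  -- Of two items of equal rank r, the earlier has no earlier twin (that
  -- would make three) and code 2r; the later has code 2r - 1 with r ≥ 1.
  ordered-codes-differ : ∀ {a b} → a ∈ as → b ∈ as → pos a < pos b → code a ≢ code b
  ordered-codes-differ {a} {b} a∈ b∈ a<b code≡ = ℕP.<⇒≢ code-b<code-a (sym code≡)
    where
    rank≡ : rank a ≡ rank b
    rank≡ = double-∸-injective (twin≤1 a) (twin≤1 b) code≡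
    a-no-twin : ¬ EarlierTwin a
    a-no-twin twin-a with z , z∈ , z<a , rz≡ra ← find twin-a =
      no-triple z∈ a∈ b∈ z<a a<b (trans rz≡ra rank≡)
    b-twin : EarlierTwin b
    b-twin = Any.map (λ { refl → a<b , rank≡ }) a∈
    code-b<code-a : code b < code a
    code-b<code-a = begin-strict
      code b               ≡⟨ cong (2 ℕ.* rank b ∸_) (twin-yes b-twin) ⟩
      2 ℕ.* rank b ∸ 1     <⟨ ℕP.∸-monoʳ-< ℕ.z<s (ℕP.≤-trans (later-positive a∈ b∈ a<b) (ℕP.m≤n*m (rank b) 2)) ⟩
      2 ℕ.* rank b         ≡⟨ cong (2 ℕ.*_) rank≡ ⟨
      2 ℕ.* rank a         ≡⟨ cong (2 ℕ.* rank a ∸_) (twin-no a-no-twin) ⟨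
      code a               ∎
      where open ℕP.≤-Reasoning

  code-injective : ∀ {a b} → a ∈ as → b ∈ as → code a ≡ code b → pos a ≡ pos b
  code-injective {a} {b} a∈ b∈ code≡ with ℕP.<-cmp (pos a) (pos b)
  ... | tri< a<b _ _ = contradiction code≡ (ordered-codes-differ a∈ b∈ a<b)
  ... | tri≈ _ a≡b _ = a≡b
  ... | tri> _ _ b<a = contradiction (sym code≡) (ordered-codes-differ b∈ a∈ b<a)

  rank-count : Unique (map pos as) → length as ≤ suc (2 ℕ.* D)
  rank-count unique = subst (_≤ suc (2 ℕ.* D)) (length-map code as)
    (unique-bounded-length (suc (2 ℕ.* D)) (map code as)
      (unique-map-transfer as code-injective unique) (map⁺ (All.tabulate code-<)))

height : ℤ → ℤ → ℕ
height base k = ℤ.∣ base ℤ.- k ∣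

height-≡ : ∀ {base k} → base ℤ.≤ k → + height base k ≡ k ℤ.- base
height-≡ = ℤP.∣-∣-≤

height-injective : ∀ {base k k'} → base ℤ.≤ k → base ℤ.≤ k' → height base k ≡ height base k' → k ≡ k'
height-injective {base} {k} {k'} b≤k b≤k' eq = begin
  k                       ≡⟨ rebase base k ⟨
  base ℤ.+ (k ℤ.- base)   ≡⟨ cong (λ d → base ℤ.+ d) (trans (sym (height-≡ b≤k)) (trans (cong +_ eq) (height-≡ b≤k'))) ⟩
  base ℤ.+ (k' ℤ.- base)  ≡⟨ rebase base k' ⟩
  k'                      ∎
  where
  open ≡-Reasoning
  rebase : ∀ b j → b ℤ.+ (j ℤ.- b) ≡ j
  rebase = solve-∀

height-mono : ∀ {base k k'} → base ℤ.≤ k → k ℤ.≤ k' → height base k ≤ height base k'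
height-mono {base} b≤k k≤k' = ℤP.drop‿+≤+ (subst₂ ℤ._≤_ (sym (height-≡ b≤k)) (sym (height-≡ (ℤP.≤-trans b≤k k≤k')))
  (ℤP.+-monoˡ-≤ (ℤ.- base) k≤k'))

height-pos : ∀ {base k} → base ℤ.< k → 0 < height base k
height-pos {base} {k} b<k with height base k in eq
... | suc _ = ℕ.z<s
... | zero  = contradiction (ℤP.i-j≡0⇒i≡j k base (trans (sym (height-≡ (ℤP.<⇒≤ b<k))) (cong +_ eq))) (λ k≡b → ℤP.<⇒≢ b<k (sym k≡b))

odd-bound : ∀ lgW rs → rs ℤ.≤ lgW → + suc (2 ℕ.* height rs lgW) ≡ + 1 ℤ.+ + 2 ℤ.* lgW ℤ.- + 2 ℤ.* rs
odd-bound lgW rs rs≤lgW = begin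
  + suc (2 ℕ.* height rs lgW)            ≡⟨ ℤP.pos-+ 1 (2 ℕ.* height rs lgW) ⟩
  + 1 ℤ.+ + (2 ℕ.* height rs lgW)        ≡⟨ cong (λ d → + 1 ℤ.+ d) (ℤP.pos-* 2 (height rs lgW)) ⟩
  + 1 ℤ.+ + 2 ℤ.* + height rs lgW        ≡⟨ cong (λ d → + 1 ℤ.+ + 2 ℤ.* d) (height-≡ rs≤lgW) ⟩
  + 1 ℤ.+ + 2 ℤ.* (lgW ℤ.- rs)           ≡⟨ distribute lgW rs ⟩
  + 1 ℤ.+ + 2 ℤ.* lgW ℤ.- + 2 ℤ.* rs     ∎
  where
  open ≡-Reasoning
  distribute : ∀ a b → + 1 ℤ.+ + 2 ℤ.* (a ℤ.- b) ≡ + 1 ℤ.+ + 2 ℤ.* a ℤ.- + 2 ℤ.* b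
  distribute = solve-∀

from-true : ∀ {A : Set} {b} → Reflects A b → b ≡ true → A
from-true r refl = invert r

from-false : ∀ {A : Set} {b} → Reflects A b → b ≡ false → ¬ A
from-false r refl = invert r

to-true : ∀ {A : Set} {b} → Reflects A b → A → b ≡ true
to-true r a = det r (ofʸ a)

to-false : ∀ {A : Set} {b} → Reflects A b → ¬ A → b ≡ false
to-false r ¬a = det r (ofⁿ ¬a)

≡ᵇ-reflects-≡ : ∀ m n → Reflects (m ≡ n) (m ≡ᵇ n)
≡ᵇ-reflects-≡ m n = fromEquivalence (ℕP.≡ᵇ⇒≡ m n) (ℕP.≡⇒≡ᵇ m n)

module Access (n : ℕ) (s : ℕ → ℕ) (P : ℕ → ℕ → Bool) (w : ℕ → ℚ) where
  open Model n s P w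

  ρ-≤ : ∀ x t → ρ x t ≤ t
  ρ-≤ x zero    = z≤n
  ρ-≤ x (suc t) with acc (suc t) x
  ... | true  = ℕP.≤-refl
  ... | false = ℕP.m≤n⇒m≤1+n (ρ-≤ x t)

  ρ-now : ∀ x i → acc i x ≡ true → ρ x i ≡ i
  ρ-now x zero    _ = refl
  ρ-now x (suc i) a rewrite a = refl

  ρ-≥ : ∀ x j t → acc j x ≡ true → 1 ≤ j → j ≤ t → j ≤ ρ x t
  ρ-≥ x j zero    _   1≤j j≤0 = contradiction j≤0 (ℕP.<⇒≱ 1≤j)
  ρ-≥ x j (suc t) a   1≤j j≤t with acc (suc t) x in eq | ℕP.m≤n⇒m<n∨m≡n j≤t
  ... | true  | _          = j≤t
  ... | false | inj₁ j<1+t = ρ-≥ x j t a 1≤j (ℕP.≤-pred j<1+t)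
  ... | false | inj₂ refl  = contradiction (trans (sym eq) a) λ ()

  ρ-accessed : ∀ x t → 1 ≤ ρ x t → acc (ρ x t) x ≡ true
  ρ-accessed x (suc t) h with acc (suc t) x in eq
  ... | true  = eq
  ... | false = ρ-accessed x t h

  leftSearch-≤ : ∀ T t k → leftSearch T t k ≤ k
  leftSearch-≤ T t zero    = z≤n
  leftSearch-≤ T t (suc k) with T ≤ᵇ ρ (suc k) t
  ... | true  = ℕP.≤-refl
  ... | false = ℕP.m≤n⇒m≤1+n (leftSearch-≤ T t k)

  leftSearch-≥ : ∀ T t k z → z ≤ k → 1 ≤ z → T ≤ ρ z t → z ≤ leftSearch T t k
  leftSearch-≥ T t zero    z z≤0 1≤z _ = contradiction z≤0 (ℕP.<⇒≱ 1≤z)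
  leftSearch-≥ T t (suc k) z z≤k 1≤z T≤ρz with T ≤ᵇ ρ (suc k) t in eq | ℕP.m≤n⇒m<n∨m≡n z≤k
  ... | true  | _          = z≤k
  ... | false | inj₁ z<1+k = leftSearch-≥ T t k z (ℕP.≤-pred z<1+k) 1≤z T≤ρz
  ... | false | inj₂ refl  = contradiction T≤ρz (from-false (ℕP.≤ᵇ-reflects-≤ T (ρ (suc k) t)) eq)

  leftSearch-skip : ∀ T t k K → k ≤ K → (∀ a → k < a → a ≤ K → ρ a t < T)
    → leftSearch T t K ≡ leftSearch T t k
  leftSearch-skip T t k zero    k≤0 _ with ℕP.n≤0⇒n≡0 k≤0
  ... | refl = refl
  leftSearch-skip T t k (suc K) k≤K old with ℕP.m≤n⇒m<n∨m≡n k≤K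
  ... | inj₂ refl = refl
  ... | inj₁ k<1+K
    rewrite to-false (ℕP.≤ᵇ-reflects-≤ T (ρ (suc K) t)) (ℕP.<⇒≱ (old (suc K) k<1+K ℕP.≤-refl)) =
    leftSearch-skip T t k K (ℕP.≤-pred k<1+K) (λ a k<a a≤K → old a k<a (ℕP.m≤n⇒m≤1+n a≤K))

  leftSearch-antitone : ∀ T T' t k → T' ≤ T → leftSearch T t k ≤ leftSearch T' t k
  leftSearch-antitone T T' t zero    _ = z≤n
  leftSearch-antitone T T' t (suc k) T'≤T
    with T ≤ᵇ ρ (suc k) t in e | T' ≤ᵇ ρ (suc k) t in e'
  ... | true  | true  = ℕP.≤-refl
  ... | true  | false = contradiction (ℕP.≤-trans T'≤T (from-true (ℕP.≤ᵇ-reflects-≤ T _) e))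
                                      (from-false (ℕP.≤ᵇ-reflects-≤ T' _) e')
  ... | false | true  = ℕP.m≤n⇒m≤1+n (leftSearch-≤ T t k)
  ... | false | false = leftSearch-antitone T T' t k T'≤T

  rightSearch-≤ : ∀ T t k y z → y ≤ z → z < y ℕ.+ k → T ≤ ρ z t → rightSearch T t k y ≤ z
  rightSearch-≤ T t zero    y z y≤z z<y+0 _ = contradiction (subst (_≤ z) (sym (ℕP.+-identityʳ y)) y≤z) (ℕP.<⇒≱ z<y+0)
  rightSearch-≤ T t (suc k) y z y≤z z<y+k T≤ρz with T ≤ᵇ ρ y t in eq | ℕP.m≤n⇒m<n∨m≡n y≤z
  ... | true  | _        = y≤z
  ... | false | inj₁ y<z = rightSearch-≤ T t k (suc y) z y<z (subst (z <_) (ℕP.+-suc y k) z<y+k) T≤ρz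
  ... | false | inj₂ refl = contradiction T≤ρz (from-false (ℕP.≤ᵇ-reflects-≤ T (ρ y t)) eq)

  rightSearch-range : ∀ T t k y → y ℕ.+ k ≤ suc n → y ≤ rightSearch T t k y × rightSearch T t k y ≤ suc n
  rightSearch-range T t zero    y y+0≤ = subst (_≤ suc n) (ℕP.+-identityʳ y) y+0≤ , ℕP.≤-refl
  rightSearch-range T t (suc k) y y+k≤ with T ≤ᵇ ρ y t
  ... | true  = ℕP.≤-refl , ℕP.≤-trans (ℕP.m≤m+n y (suc k)) y+k≤
  ... | false with rightSearch-range T t k (suc y) (subst (_≤ suc n) (ℕP.+-suc y k) y+k≤)
  ...   | y<r , r≤ = ℕP.<⇒≤ y<r , r≤

  leftEnd-< : ∀ {x} t → 1 ≤ x → leftEnd x t < x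
  leftEnd-< {suc x} t _ = s≤s (leftSearch-≤ (ρ (suc x) t) t x)

  rightEnd-range : ∀ {x} t → x ≤ n → x < rightEnd x t × rightEnd x t ≤ suc n
  rightEnd-range {x} t x≤n =
    rightSearch-range (ρ x t) t (n ∸ x) (suc x) (ℕP.≤-reflexive (cong suc (ℕP.m+[n∸m]≡n x≤n)))

  leftEnd-≥ : ∀ {x p} t → 1 ≤ p → p < x → ρ x t ≤ ρ p t → p ≤ leftEnd x t
  leftEnd-≥ {suc x} {p} t 1≤p (s≤s p≤x) = leftSearch-≥ (ρ (suc x) t) t x p p≤x 1≤p

  rightEnd-≤ : ∀ {x y} t → x < y → y ≤ n → ρ x t ≤ ρ y t → rightEnd x t ≤ y
  rightEnd-≤ {x} {y} t x<y y≤n =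
    rightSearch-≤ (ρ x t) t (n ∸ x) (suc x) y x<y
      (subst (y <_) (sym (cong suc (ℕP.m+[n∸m]≡n (ℕP.<⇒≤ (ℕP.<-≤-trans x<y y≤n))))) (s≤s y≤n))

  leftEnd-dominates : ∀ {x y} t → 1 ≤ x → x < y → (∀ z → x ≤ z → z < y → ρ z t < ρ y t)
    → leftEnd y t ≤ leftEnd x t
  leftEnd-dominates {suc x} {suc y} t _ x<y older = begin
    leftSearch (ρ (suc y) t) t y  ≡⟨ leftSearch-skip (ρ (suc y) t) t x y (ℕP.≤-pred (ℕP.<⇒≤ x<y))
                                       (λ a x<a a≤y → older a x<a (s≤s a≤y)) ⟩
    leftSearch (ρ (suc y) t) t x  ≤⟨ leftSearch-antitone (ρ (suc y) t) (ρ (suc x) t) t x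
                                       (ℕP.<⇒≤ (older (suc x) ℕP.≤-refl x<y)) ⟩
    leftSearch (ρ (suc x) t) t x  ∎
    where open ℕP.≤-Reasoning

allFrom : (ℕ → Bool) → ℕ → ℕ → Bool
allFrom f lo zero      = true
allFrom f lo (suc len) = f lo ∧ allFrom f (suc lo) len

allFrom-true : ∀ f lo len → allFrom f lo len ≡ true → ∀ z → lo ≤ z → z < lo ℕ.+ len → f z ≡ true
allFrom-true f lo zero      _  z lo≤z z<lo+0 = contradiction (subst (_≤ z) (sym (ℕP.+-identityʳ lo)) lo≤z) (ℕP.<⇒≱ z<lo+0)
allFrom-true f lo (suc len) eq z lo≤z z<lo+len with f lo in f-lo | ℕP.m≤n⇒m<n∨m≡n lo≤z
... | true | inj₂ refl = f-lo
... | true | inj₁ lo<z = allFrom-true f (suc lo) len eq z lo<z (subst (z <_) (ℕP.+-suc lo len) z<lo+len)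

allFrom-false : ∀ f lo len → allFrom f lo len ≡ false → ∃[ z ] lo ≤ z × z < lo ℕ.+ len × f z ≡ false
allFrom-false f lo (suc len) eq with f lo in f-lo
... | false = lo , ℕP.≤-refl , ℕP.m<m+n lo ℕ.z<s , f-lo
... | true with z , lo<z , z<end , fz ← allFrom-false f (suc lo) len eq =
  z , ℕP.<⇒≤ lo<z , subst (z <_) (sym (ℕP.+-suc lo len)) z<end , fz

Between : ℕ → ℕ → ℕ → Set
Between a b c = a ⊓ b ≤ c × c ≤ a ⊔ b

between : ∀ {a b c} → a ≤ c → c ≤ b → Between a b c
between {a} {b} a≤c c≤b = ℕP.≤-trans (ℕP.m⊓n≤m a b) a≤c , ℕP.≤-trans c≤b (ℕP.m≤n⊔m a b)

between-flip : ∀ {a b c} → Between a b c → Between b a c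
between-flip {a} {b} (lo , hi) = subst (_≤ _) (ℕP.⊓-comm a b) lo , subst (_ ≤_) (ℕP.⊔-comm a b) hi

between-left : ∀ {a b} → Between a b a
between-left {a} {b} = ℕP.m⊓n≤m a b , ℕP.m≤m⊔n a b

between-narrow : ∀ {a b c d} → Between a b c → Between c b d → Between a b d
between-narrow {a} {b} {c} (a⊓b≤c , c≤a⊔b) (c⊓b≤d , d≤c⊔b) =
  ℕP.≤-trans (ℕP.⊓-glb a⊓b≤c (ℕP.m⊓n≤n a b)) c⊓b≤d ,
  ℕP.≤-trans d≤c⊔b (ℕP.⊔-lub c≤a⊔b (ℕP.m≤n⊔m a b))

between-ordered : ∀ {a b c} → a ≤ b → Between a b c → a ≤ c × c ≤ b
between-ordered {a} {b} a≤b (lo , hi) =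
  subst (_≤ _) (ℕP.m≤n⇒m⊓n≡m a≤b) lo , subst (_ ≤_) (ℕP.m≤n⇒m⊔n≡n a≤b) hi

-- A point of Z other than (x₁,y₁) and (x₂,y₂) in their closed rectangle,
-- laid out exactly as in the definition of ArborallySatisfied.
Witness : PointSet → ℕ → ℕ → ℕ → ℕ → Set
Witness Z x₁ y₁ x₂ y₂ = Σ ℕ λ x₃ → Σ ℕ λ y₃ → Z x₃ y₃
  × ¬ (x₃ ≡ x₁ × y₃ ≡ y₁) × ¬ (x₃ ≡ x₂ × y₃ ≡ y₂)
  × x₁ ⊓ x₂ ≤ x₃ × x₃ ≤ x₁ ⊔ x₂ × y₁ ⊓ y₂ ≤ y₃ × y₃ ≤ y₁ ⊔ y₂

Satisfied : PointSet → ℕ → ℕ → ℕ → ℕ → Set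
Satisfied Z x₁ y₁ x₂ y₂ = x₁ ≡ x₂ ⊎ y₁ ≡ y₂ ⊎ Witness Z x₁ y₁ x₂ y₂

witness : ∀ {Z x₁ y₁ x₂ y₂} x₃ y₃ → Z x₃ y₃ → ¬ (x₃ ≡ x₁ × y₃ ≡ y₁) → ¬ (x₃ ≡ x₂ × y₃ ≡ y₂)
  → Between x₁ x₂ x₃ → Between y₁ y₂ y₃ → Witness Z x₁ y₁ x₂ y₂
witness x₃ y₃ z ne₁ ne₂ (xl , xh) (yl , yh) = x₃ , y₃ , z , ne₁ , ne₂ , xl , xh , yl , yh

witness-sym : ∀ {Z x₁ y₁ x₂ y₂} → Witness Z x₁ y₁ x₂ y₂ → Witness Z x₂ y₂ x₁ y₁
witness-sym (x₃ , y₃ , z , ne₁ , ne₂ , xl , xh , yl , yh) =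
  witness x₃ y₃ z ne₂ ne₁ (between-flip (xl , xh)) (between-flip (yl , yh))

satisfied-sym : ∀ {Z x₁ y₁ x₂ y₂} → Satisfied Z x₁ y₁ x₂ y₂ → Satisfied Z x₂ y₂ x₁ y₁
satisfied-sym (inj₁ x≡)         = inj₁ (sym x≡)
satisfied-sym (inj₂ (inj₁ y≡))  = inj₂ (inj₁ (sym y≡))
satisfied-sym (inj₂ (inj₂ wit)) = inj₂ (inj₂ (witness-sym wit))

strict-witness : ∀ {Z x₁ y₁ x₂ y₂} → ArborallySatisfied Z → Z x₁ y₁ → Z x₂ y₂
  → x₁ ≢ x₂ → y₁ ≢ y₂ → Witness Z x₁ y₁ x₂ y₂
strict-witness {x₁ = x₁} {y₁} {x₂} {y₂} AS p q x≢ y≢ with AS x₁ y₁ x₂ y₂ p q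
... | inj₁ x≡         = contradiction x≡ x≢
... | inj₂ (inj₁ y≡)  = contradiction y≡ y≢
... | inj₂ (inj₂ wit) = wit

-- The staircase property of GreedyASS at time i = t + 1: an element y > s_i
-- accessed at time i was last accessed (before i) after every element of
-- [s_i, y).  Otherwise dropping from row i every point right of s_i that
-- violates this keeps the set arborally satisfied, contradicting minimality.
module Staircase (n : ℕ) (s : ℕ → ℕ) (P : ℕ → ℕ → Bool) (w : ℕ → ℚ) (t : ℕ) where
  open Model n s P w
  open Access n s P w

  private
    i si : ℕ
    i  = suc t
    si = s i

  stair? : ℕ → Bool
  stair? y = allFrom (λ z → ρ z t <ᵇ ρ y t) si (y ∸ si)

  kept? : ℕ → Bool
  kept? x = P i x ∧ ((x ≤ᵇ si) ∨ stair? x)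

  Old New : PointSet
  Old = PointsUpTo s P i
  New = PointsUpTo s (replaceRow P i kept?) i

  Removed : ℕ → Set
  Removed v = ∃[ z ] si ≤ z × z < v × ρ v t ≤ ρ z t

  private
    ≡ᵇ-refl : ∀ x → (x ≡ᵇ x) ≡ true
    ≡ᵇ-refl x = to-true (≡ᵇ-reflects-≡ x x) refl

    ≡ᵇ-≢ : ∀ {x y} → x ≢ y → (x ≡ᵇ y) ≡ false
    ≡ᵇ-≢ {x} {y} = to-false (≡ᵇ-reflects-≡ x y)

    i≢ : ∀ {y} → y < i → (y ≡ᵇ i) ≡ false
    i≢ y<i = ≡ᵇ-≢ (ℕP.<⇒≢ y<i)

    below-y : ∀ {y z} → si < y → z < y → z < si ℕ.+ (y ∸ si)
    below-y si<y z<y = subst (_ <_) (sym (ℕP.m+[n∸m]≡n (ℕP.<⇒≤ si<y))) z<y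

  stair?-true : ∀ {y} → stair? y ≡ true → si < y → ∀ z → si ≤ z → z < y → ρ z t < ρ y t
  stair?-true {y} eq si<y z si≤z z<y = from-true (ℕP.<ᵇ-reflects-< (ρ z t) (ρ y t))
    (allFrom-true _ si (y ∸ si) eq z si≤z (below-y si<y z<y))

  stair?-false : ∀ {y} → stair? y ≡ false → si < y → Removed y
  stair?-false {y} eq si<y with z , si≤z , z<end , ρy≮ρz ← allFrom-false _ si (y ∸ si) eq =
    z , si≤z , subst (z <_) (ℕP.m+[n∸m]≡n (ℕP.<⇒≤ si<y)) z<end ,
    ℕP.≮⇒≥ (from-false (ℕP.<ᵇ-reflects-< (ρ z t) (ρ y t)) ρy≮ρz)

  private
    ∧-true : ∀ {a b} → a ∧ b ≡ true → a ≡ true × b ≡ true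
    ∧-true {true} b≡ = refl , b≡

    ∨-true : ∀ {a b} → a ∨ b ≡ true → a ≡ false → b ≡ true
    ∨-true {false} b≡ _ = b≡

  old-accessed : ∀ {x y} → Old x y → acc y x ≡ true
  old-accessed {y = y} (_ , _ , inj₁ refl) rewrite ≡ᵇ-refl (s y) = refl
  old-accessed {x} {y} (_ , _ , inj₂ P-yx) rewrite P-yx = ∨-zeroʳ (s y ≡ᵇ x)

  accessed-old : ∀ {x y} → 1 ≤ y → y ≤ i → acc y x ≡ true → Old x y
  accessed-old {x} {y} 1≤y y≤i accessed with s y ≡ᵇ x in eq
  ... | true  = 1≤y , y≤i , inj₁ (sym (from-true (≡ᵇ-reflects-≡ (s y) x) eq))
  ... | false = 1≤y , y≤i , inj₂ accessed

  old⇒new : ∀ {x y} → Old x y → y < i → New x y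
  old⇒new (1≤y , y≤i , p) y<i rewrite i≢ y<i = 1≤y , y≤i , p

  new⇒old : ∀ {x y} → New x y → y < i → Old x y
  new⇒old (1≤y , y≤i , p) y<i rewrite i≢ y<i = 1≤y , y≤i , p

  Kept : ℕ → Set
  Kept x = x ≡ si ⊎ kept? x ≡ true

  new-row : ∀ {x} → New x i → Kept x
  new-row (_ , _ , p) rewrite ≡ᵇ-refl i = p

  kept⇒new : ∀ {x} → Kept x → New x i
  kept⇒new {x} k = ℕ.z<s , ℕP.≤-refl ,
    subst (λ b → x ≡ si ⊎ (if b then kept? x else P i x) ≡ true) (sym (≡ᵇ-refl i)) k

  kept⇒old : ∀ {x} → Kept x → Old x i
  kept⇒old (inj₁ x≡si) = ℕ.z<s , ℕP.≤-refl , inj₁ x≡si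
  kept⇒old (inj₂ k)    = ℕ.z<s , ℕP.≤-refl , inj₂ (proj₁ (∧-true k))

  last-access : ∀ {c} → 1 ≤ ρ c t → New c (ρ c t)
  last-access {c} 1≤ρ =
    old⇒new (accessed-old 1≤ρ (ℕP.m≤n⇒m≤1+n (ρ-≤ c t)) (ρ-accessed c t 1≤ρ)) (s≤s (ρ-≤ c t))

  kept?-intro : ∀ {x} → P i x ≡ true → (x ≤ᵇ si) ≡ true ⊎ stair? x ≡ true → kept? x ≡ true
  kept?-intro {x} P-ix (inj₁ le) rewrite P-ix | le = refl
  kept?-intro {x} P-ix (inj₂ st) rewrite P-ix | st = ∨-zeroʳ (x ≤ᵇ si)

  kept-left : ∀ {v} → Old v i → v ≤ si → New v i
  kept-left (_ , _ , inj₁ v≡si) _ = kept⇒new (inj₁ v≡si)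
  kept-left {v} (_ , _ , inj₂ P-iv) v≤si =
    kept⇒new (inj₂ (kept?-intro P-iv (inj₁ (to-true (ℕP.≤ᵇ-reflects-≤ v si) v≤si))))

  kept-or-removed : ∀ {v} → Old v i → New v i ⊎ Removed v
  kept-or-removed (_ , _ , inj₁ v≡si) = inj₁ (kept⇒new (inj₁ v≡si))
  kept-or-removed {v} old@(_ , _ , inj₂ P-iv) with v ℕP.≤? si
  ... | yes v≤si = inj₁ (kept-left old v≤si)
  ... | no  v≰si = stair-or-removed (stair? v) refl
    where
    stair-or-removed : ∀ b → stair? v ≡ b → New v i ⊎ Removed v
    stair-or-removed true  st = inj₁ (kept⇒new (inj₂ (kept?-intro P-iv (inj₂ st))))
    stair-or-removed false st = inj₂ (stair?-false st (ℕP.≰⇒> v≰si))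

  kept-stair : ∀ {u} → New u i → si < u → ∀ z → si ≤ z → z < u → ρ z t < ρ u t
  kept-stair {u} new-u si<u with new-row new-u
  ... | inj₁ u≡si = contradiction (sym u≡si) (ℕP.<⇒≢ si<u)
  ... | inj₂ k    = stair?-true (∨-true (proj₂ (∧-true k)) (to-false (ℕP.≤ᵇ-reflects-≤ u si) (ℕP.<⇒≱ si<u))) si<u

  module RowAndBelow (old-AS : ArborallySatisfied Old) {u q qy : ℕ}
    (new-u : New u i) (old-q : Old q qy) (qy<i : qy < i) where

    private
      i≢qy : i ≢ qy
      i≢qy i≡qy = ℕP.<⇒≢ qy<i (sym i≡qy)

      rows : ∀ {y} → qy ≤ y → y ≤ i → Between i qy y
      rows qy≤y y≤i = between-flip (between qy≤y y≤i)

    qy≤ρq : qy ≤ ρ q t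
    qy≤ρq = ρ-≥ q qy t (old-accessed old-q) (proj₁ old-q) (ℕP.≤-pred qy<i)

    access-witness : ∀ {c} → c ≢ q → Between u q c → qy ≤ ρ c t → Witness New u i q qy
    access-witness {c} c≢q c-between qy≤ρc =
      witness c (ρ c t) (last-access (ℕP.≤-trans (proj₁ old-q) qy≤ρc))
        (λ (_ , ρ≡i) → ℕP.<⇒≢ (s≤s (ρ-≤ c t)) ρ≡i) (λ (c≡q , _) → c≢q c≡q)
        c-between (rows qy≤ρc (ℕP.m≤n⇒m≤1+n (ρ-≤ c t)))

    row-witness : ∀ {c} → New c i → c ≢ u → Between u q c → Witness New u i q qy
    row-witness {c} new-c c≢u c-between =
      witness c i new-c (λ (c≡u , _) → c≢u c≡u) (λ (_ , i≡qy) → i≢qy i≡qy)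
        c-between (rows (ℕP.<⇒≤ qy<i) ℕP.≤-refl)

    split-witness : ∀ {v} → Between u q v → Witness Old v i q qy
      → Witness New u i q qy ⊎ ∃[ x ] Old x i × x ≢ v × Between v q x
    split-witness v-between (x₃ , y₃ , old₃ , ≢v , ≢q , xl , xh , yl , yh)
      with qy≤y₃ , y₃≤i ← between-ordered (ℕP.<⇒≤ qy<i) (between-flip (yl , yh))
      with y₃ ℕP.<? i
    ... | yes y₃<i = inj₁ (witness x₃ y₃ (old⇒new old₃ y₃<i) (λ (_ , y₃≡i) → ℕP.<⇒≢ y₃<i y₃≡i) ≢q
                       (between-narrow v-between (xl , xh)) (rows qy≤y₃ (ℕP.<⇒≤ y₃<i)))
    ... | no  y₃≮i with refl ← ℕP.≤-antisym y₃≤i (ℕP.≮⇒≥ y₃≮i) =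
      inj₂ (x₃ , old₃ , (λ x₃≡v → ≢v (x₃≡v , refl)) , (xl , xh))

    old-witness : ∀ {v} → Old v i → v ≢ q → Witness Old v i q qy
    old-witness old-v v≢q = strict-witness old-AS old-v old-q v≢q i≢qy

    -- u < q: walk right along row i.  Each old witness is below row i
    -- (done), a kept point (done), or a removed point closer to q.
    module Rightward (u<q : u < q) where

      -- A removed (q, i) is bypassed by the element z that made it a non-stair.
      removed-end : Removed q → Witness New u i q qy
      removed-end (z , si≤z , z<q , ρq≤ρz) with u ℕP.≤? z
      ... | yes u≤z = access-witness (ℕP.<⇒≢ z<q) (between u≤z (ℕP.<⇒≤ z<q)) (ℕP.≤-trans qy≤ρq ρq≤ρz)
      ... | no  u≰z = access-witness (ℕP.<⇒≢ u<q) between-left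
                        (ℕP.<⇒≤ (ℕP.≤-<-trans (ℕP.≤-trans qy≤ρq ρq≤ρz) (kept-stair new-u si<u z si≤z z<u)))
        where
        z<u = ℕP.≰⇒> u≰z
        si<u = ℕP.≤-<-trans si≤z z<u

      -- The walk from a row-i point v ≥ u; the fuel bounds the distance q - v.
      mutual
        walk : ∀ fuel {v} → q ∸ v ≤ fuel → u ≤ v → v < q → Old v i → Witness New u i q qy
        walk zero       bound _   v<q _     = contradiction bound (ℕP.<⇒≱ (ℕP.m<n⇒0<n∸m v<q))
        walk (suc fuel) bound u≤v v<q old-v
          with split-witness (between u≤v (ℕP.<⇒≤ v<q)) (old-witness old-v (ℕP.<⇒≢ v<q))
        ... | inj₁ done = done
        ... | inj₂ (x , old-x , x≢v , x-between)
          with v≤x , x≤q ← between-ordered (ℕP.<⇒≤ v<q) x-between =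
          advance fuel bound u≤v (ℕP.≤∧≢⇒< v≤x (λ v≡x → x≢v (sym v≡x))) x≤q old-x

        advance : ∀ fuel {v x} → q ∸ v ≤ suc fuel → u ≤ v → v < x → x ≤ q → Old x i → Witness New u i q qy
        advance fuel {v} {x} bound u≤v v<x x≤q old-x with kept-or-removed old-x
        ... | inj₁ new-x = row-witness new-x (λ x≡u → ℕP.<⇒≢ u<x (sym x≡u)) (between (ℕP.<⇒≤ u<x) x≤q)
          where u<x = ℕP.≤-<-trans u≤v v<x
        ... | inj₂ removed with x ℕP.≟ q
        ...   | yes refl = removed-end removed
        ...   | no  x≢q  = walk fuel (ℕP.≤-pred (ℕP.≤-trans (ℕP.∸-monoʳ-< v<x x≤q) bound))
                             (ℕP.≤-trans u≤v (ℕP.<⇒≤ v<x)) (ℕP.≤∧≢⇒< x≤q x≢q) old-x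

      result : Witness New u i q qy
      result = walk (q ∸ u) ℕP.≤-refl ℕP.≤-refl u<q (kept⇒old (new-row new-u))

    -- q < u: if u ≤ s_i every row-i point in range is kept; if s_i < u
    -- then u is a stair, or s_i itself lies strictly between q and u.
    leftward : q < u → Witness New u i q qy
    leftward q<u with u ℕP.≤? si
    ... | yes u≤si with split-witness between-left (old-witness (kept⇒old (new-row new-u)) (ℕP.>⇒≢ q<u))
    ...   | inj₁ done = done
    ...   | inj₂ (x , old-x , x≢u , x-between) =
      row-witness (kept-left old-x (ℕP.≤-trans (ℕP.<⇒≤ x<u) u≤si)) x≢u x-between
      where x<u = ℕP.≤∧≢⇒< (proj₂ (between-ordered (ℕP.<⇒≤ q<u) (between-flip x-between))) x≢u
    leftward q<u | no u≰si with si ℕP.≤? q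
    ... | yes si≤q = access-witness (ℕP.>⇒≢ q<u) between-left
                       (ℕP.≤-trans qy≤ρq (ℕP.<⇒≤ (kept-stair new-u (ℕP.≰⇒> u≰si) q si≤q q<u)))
    ... | no  si≰q = row-witness (kept⇒new (inj₁ refl)) (ℕP.<⇒≢ (ℕP.≰⇒> u≰si))
                       (between-flip (between (ℕP.<⇒≤ (ℕP.≰⇒> si≰q)) (ℕP.<⇒≤ (ℕP.≰⇒> u≰si))))

    row-and-below : u ≢ q → Witness New u i q qy
    row-and-below u≢q with ℕP.<-cmp u q
    ... | tri< u<q _ _ = Rightward.result u<q
    ... | tri≈ _ u≡q _ = contradiction u≡q u≢q
    ... | tri> _ _ q<u = leftward q<u

  on-row-i : ∀ {x y} → New x y → ¬ y < i → y ≡ i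
  on-row-i (_ , y≤i , _) y≮i = ℕP.≤-antisym y≤i (ℕP.≮⇒≥ y≮i)

  row-pair : ArborallySatisfied Old → ∀ {x₁ y₁ x₂ y₂} → y₁ ≡ i → New x₁ y₁ → New x₂ y₂ → y₂ < i
    → Satisfied New x₁ y₁ x₂ y₂
  row-pair old-AS {x₁} {x₂ = x₂} refl p₁ p₂ y₂<i with x₁ ℕP.≟ x₂
  ... | yes x₁≡x₂ = inj₁ x₁≡x₂
  ... | no  x₁≢x₂ = inj₂ (inj₂ (RowAndBelow.row-and-below old-AS p₁ (new⇒old p₂ y₂<i) y₂<i x₁≢x₂))

  new-AS : ArborallySatisfied Old → ArborallySatisfied New
  new-AS old-AS x₁ y₁ x₂ y₂ p₁ p₂ with y₁ ℕP.<? i | y₂ ℕP.<? i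
  ... | yes y₁<i | yes y₂<i = below (old-AS x₁ y₁ x₂ y₂ (new⇒old p₁ y₁<i) (new⇒old p₂ y₂<i))
    where
    below : Satisfied Old x₁ y₁ x₂ y₂ → Satisfied New x₁ y₁ x₂ y₂
    below (inj₁ x≡) = inj₁ x≡
    below (inj₂ (inj₁ y≡)) = inj₂ (inj₁ y≡)
    below (inj₂ (inj₂ (x₃ , y₃ , old₃ , rest@(_ , _ , _ , _ , _ , y₃≤)))) =
      inj₂ (inj₂ (x₃ , y₃ , old⇒new old₃ (ℕP.≤-<-trans y₃≤ (ℕP.⊔-pres-<m y₁<i y₂<i)) , rest))
  ... | no  y₁≮i | no  y₂≮i = inj₂ (inj₁ (trans (on-row-i p₁ y₁≮i) (sym (on-row-i p₂ y₂≮i))))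
  ... | no  y₁≮i | yes y₂<i = row-pair old-AS (on-row-i p₁ y₁≮i) p₁ p₂ y₂<i
  ... | yes y₁<i | no  y₂≮i = satisfied-sym (row-pair old-AS (on-row-i p₂ y₂≮i) p₂ p₁ y₁<i)

  staircase : ∀ m → IsGreedyASS n m s P → i ≤ m → ∀ {y} → acc i y ≡ true → si < y
    → ∀ z → si ≤ z → z < y → ρ z t < ρ y t
  staircase m greedy i≤m {y} acc-y si<y z si≤z z<y with ρ z t ℕP.<? ρ y t
  ... | yes ρz<ρy = ρz<ρy
  ... | no  ρz≮ρy = ⊥-elim (minimal kept? (λ x k → proj₁ (∧-true k)) (y , P-iy , y-dropped) (new-AS old-AS))
    where
    old-AS  = proj₁ (proj₂ (greedy i ℕ.z<s i≤m))
    minimal = proj₂ (proj₂ (greedy i ℕ.z<s i≤m))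
    P-iy : P i y ≡ true
    P-iy = subst (λ b → (b ∨ P i y) ≡ true) (≡ᵇ-≢ (ℕP.<⇒≢ si<y)) acc-y
    not-stair : stair? y ≡ false
    not-stair = ¬-not (λ st → ρz≮ρy (stair?-true st si<y z si≤z z<y))
    y-dropped : kept? y ≡ false
    y-dropped rewrite P-iy | to-false (ℕP.≤ᵇ-reflects-≤ y si) (ℕP.<⇒≱ si<y) | not-stair = refl

module Intervals (n m : ℕ) (s : ℕ → ℕ) (w : ℕ → ℚ) (P : ℕ → ℕ → Bool)
  (s-range : ∀ j → 1 ≤ j → j ≤ m → 1 ≤ s j × s j ≤ n)
  (w-pos : ∀ x → 1 ≤ x → x ≤ n → 0ℚ ℚ.< w x)
  (greedy : IsGreedyASS n m s P)
  (t : ℕ) (i≤m : suc t ≤ m) where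

  open Model n s P w
  open Access n s P w
  open IntervalWeight n w w-pos
  open Staircase n s P w t using (staircase)

  private
    i si : ℕ
    i  = suc t
    si = s i

  si-range : 1 ≤ si × si ≤ n
  si-range = s-range i ℕ.z<s i≤m

  accessed-range : ∀ {y} → acc i y ≡ true → 1 ≤ y × y ≤ n
  accessed-range {y} acc-y with s i ℕ.≡ᵇ y in eq
  ... | true  = subst (λ z → 1 ≤ z × z ≤ n) (from-true (≡ᵇ-reflects-≡ si y) eq) si-range
  ... | false = proj₁ (greedy i ℕ.z<s i≤m) y acc-y

  si-accessed : acc i si ≡ true
  si-accessed rewrite to-true (≡ᵇ-reflects-≡ si si) refl = refl

  σ-≤-W : ∀ {x} τ → 1 ≤ x → x ≤ n → σ x τ ℚ.≤ W
  σ-≤-W {x} τ 1≤x x≤n = weight-mono 1 (suc (leftEnd x τ)) (rightEnd x τ) (suc n) ℕ.z<s ℕ.z<s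
    (ℕP.≤-trans (leftEnd-< τ 1≤x) (ℕP.<⇒≤ (proj₁ (rightEnd-range τ x≤n)))) (proj₂ (rightEnd-range τ x≤n)) ℕP.≤-refl

  -- By the staircase property, for y > s_i accessed at time i, Γ(y, i-1)
  -- contains Γ(s_i, i-1), which ends before y.
  module After {y} (acc-y : acc i y ≡ true) (si<y : si < y) where
    y≤n : y ≤ n
    y≤n = proj₂ (accessed-range acc-y)

    left : leftEnd y t ≤ leftEnd si t
    left = leftEnd-dominates t (proj₁ si-range) si<y (staircase m greedy i≤m acc-y si<y)

    Γsi-before-y : rightEnd si t ≤ y
    Γsi-before-y = rightEnd-≤ t si<y y≤n (ℕP.<⇒≤ (staircase m greedy i≤m acc-y si<y si ℕP.≤-refl si<y))

    σsi-≤ : σ si t ℚ.≤ σ y t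
    σsi-≤ = weight-mono (suc (leftEnd y t)) (suc (leftEnd si t)) (rightEnd si t) (rightEnd y t) ℕ.z<s (s≤s left)
      (ℕP.≤-trans (leftEnd-< t (proj₁ si-range)) (ℕP.<⇒≤ (proj₁ (rightEnd-range t (proj₂ si-range)))))
      (ℕP.≤-trans Γsi-before-y (ℕP.<⇒≤ (proj₁ (rightEnd-range t y≤n)))) (proj₂ (rightEnd-range t y≤n))

  module Succ {x y} (acc-x : acc i x ≡ true) (succ : IsSuccessor i x y) where
    acc-y : acc i y ≡ true
    acc-y = proj₁ (proj₂ succ)

    after : ∀ {p} → acc i p ≡ true → p < x → p ≤ leftEnd x i
    after {p} acc-p p<x = leftEnd-≥ i (proj₁ (accessed-range acc-p)) p<x
      (ℕP.≤-reflexive (trans (ρ-now x i acc-x) (sym (ρ-now p i acc-p))))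

    successor-first : ∀ {x'} → acc i x' ≡ true → x < x' → y ≤ x'
    successor-first acc-x' x<x' = ℕP.≮⇒≥ (λ x'<y → contradiction (trans (sym (proj₂ (proj₂ succ) _ x<x' x'<y)) acc-x') λ ())

    before : rightEnd x i ≤ y
    before = rightEnd-≤ i (proj₁ succ) (proj₂ (accessed-range acc-y))
      (ℕP.≤-reflexive (trans (ρ-now x i acc-x) (sym (ρ-now y i acc-y))))

    packed : ∀ {lo hi} → si < x → leftEnd y t < lo → lo ≤ hi → hi ≤ suc (leftEnd x i)
      → weight lo hi ℚ.+ σ x i ℚ.≤ σ y t
    packed si<x left<lo lo≤hi hi≤ =
      weight-disjoint (suc (leftEnd y t)) _ _ (suc (leftEnd x i)) (rightEnd x i) (rightEnd y t) ℕ.z<s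
        left<lo lo≤hi hi≤
        (ℕP.≤-trans (leftEnd-< i (proj₁ x-range)) (ℕP.<⇒≤ (proj₁ (rightEnd-range i (proj₂ x-range)))))
        (ℕP.≤-trans before (ℕP.<⇒≤ (proj₁ (rightEnd-range t y≤n)))) (proj₂ (rightEnd-range t y≤n))
      where
      x-range = accessed-range acc-x
      y≤n = proj₂ (accessed-range acc-y)

  Item : Set
  Item = Σ ℕ (Stubborn i)

  position : Item → ℕ
  position = proj₁

  -- The common rank of Γ(x, i) and Γ(y, i-1) for the successor y of x.
  rank : Item → ℤ
  rank (_ , _ , _ , _ , _ , k , _) = k

  items : ∀ {L} → All (Stubborn i) L → List Item
  items = All.toList

  items-positions : ∀ {L} (ps : All (Stubborn i) L) → map position (items ps) ≡ L
  items-positions []       = refl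
  items-positions (p ∷ ps) = cong (_ ∷_) (items-positions ps)

  module Ranks (lgW rs : ℤ) (fW : FloorLg W lgW) (fsi : FloorLg (σ si t) rs) where

    -- σ(s_i, i-1) ≤ σ(y, i-1) ≤ W for the successor y of a stubborn element.
    rank-range : ∀ a → rs ℤ.≤ rank a × rank a ℤ.≤ lgW
    rank-range (x , acc-x , si<x , y , succ , k , _ , fy) =
      floorLg-mono fsi fy (After.σsi-≤ (Succ.acc-y acc-x succ) si<y) ,
      floorLg-mono fy fW (σ-≤-W t (proj₁ y-range) (proj₂ y-range))
      where
      si<y = ℕP.<-trans si<x (proj₁ succ)
      y-range = accessed-range (Succ.acc-y acc-x succ)

    -- For stubborn x < x' < x'', the intervals Γ(x, i) and Γ(x'', i) both
    -- lie in Γ(y'', i-1), so the rank of x is below that of x''.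
    rank-< : ∀ a b c → position a < position b → position b < position c → rank a ℤ.< rank c
    rank-< (x , acc-x , si<x , y , succ , _ , fx , _) (x' , acc-x' , _)
           (x'' , acc-x'' , si<x'' , y'' , succ'' , _ , fx'' , fy'') x<x' x'<x'' =
      floorLg-sum fx fx'' fy'' (Succ.packed acc-x'' succ'' si<x'' left<lo lo≤hi hi≤)
      where
      si<y'' = ℕP.<-trans si<x'' (proj₁ succ'')
      left<lo : leftEnd y'' t < suc (leftEnd x i)
      left<lo = s≤s (ℕP.≤-trans (After.left (Succ.acc-y acc-x'' succ'') si<y'')
                  (ℕP.≤-trans (ℕP.<⇒≤ (leftEnd-< t (proj₁ si-range))) (Succ.after acc-x succ si-accessed si<x)))
      lo≤hi : suc (leftEnd x i) ≤ rightEnd x i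
      lo≤hi = ℕP.≤-trans (leftEnd-< i (proj₁ (accessed-range acc-x)))
                (ℕP.<⇒≤ (proj₁ (rightEnd-range i (proj₂ (accessed-range acc-x)))))
      hi≤ : rightEnd x i ≤ suc (leftEnd x'' i)
      hi≤ = ℕP.≤-trans (Succ.before acc-x succ) (ℕP.m≤n⇒m≤1+n (Succ.after acc-x'' succ'' (Succ.acc-y acc-x succ)
              (ℕP.≤-<-trans (Succ.successor-first acc-x succ acc-x' x<x') x'<x'')))

    -- For stubborn x < x', Γ(s_i, i-1) and Γ(x', i) both lie in Γ(y', i-1).
    rank-above : ∀ a b → position a < position b → rs ℤ.< rank b
    rank-above (x , acc-x , si<x , _) (x' , acc-x' , si<x' , y' , succ' , _ , fx' , fy') x<x' =
      floorLg-sum fsi fx' fy' (Succ.packed acc-x' succ' si<x' left<lo lo≤hi hi≤)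
      where
      left<lo : leftEnd y' t < suc (leftEnd si t)
      left<lo = s≤s (After.left (Succ.acc-y acc-x' succ') (ℕP.<-trans si<x' (proj₁ succ')))
      lo≤hi : suc (leftEnd si t) ≤ rightEnd si t
      lo≤hi = ℕP.≤-trans (leftEnd-< t (proj₁ si-range)) (ℕP.<⇒≤ (proj₁ (rightEnd-range t (proj₂ si-range))))
      hi≤ : rightEnd si t ≤ suc (leftEnd x' i)
      hi≤ = ℕP.≤-trans (After.Γsi-before-y acc-x si<x) (ℕP.m≤n⇒m≤1+n (Succ.after acc-x' succ' acc-x x<x'))

    rs≤lgW : rs ℤ.≤ lgW
    rs≤lgW = floorLg-mono fsi fW (σ-≤-W t (proj₁ si-range) (proj₂ si-range))

    level : Item → ℕ
    level a = height rs (rank a)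

    stubborn-count : (as : List Item) → Unique (map position as) → length as ≤ suc (2 ℕ.* height rs lgW)
    stubborn-count as = RankCounting.rank-count position level (height rs lgW) as
      (λ {a} _ → height-mono (proj₁ (rank-range a)) (proj₂ (rank-range a)))
      (λ {a} {b} {c} _ _ _ a<b b<c same → ℤP.<⇒≢ (rank-< a b c a<b b<c)
         (height-injective (proj₁ (rank-range a)) (proj₁ (rank-range c)) same))
      (λ {a} {b} _ _ a<b → height-pos (rank-above a b a<b))

lemma4 : (n m : ℕ) (s : ℕ → ℕ) (w : ℕ → ℚ) (P : ℕ → ℕ → Bool)
    → (∀ j → 1 ≤ j → j ≤ m → 1 ≤ s j × s j ≤ n)
    → (∀ x → 1 ≤ x → x ≤ n → 0ℚ ℚ.< w x)
    → IsGreedyASS n m s P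
    → (i : ℕ) → 1 ≤ i → i ≤ m
    → (lgW rs : ℤ)
    → FloorLg (Model.W n s P w) lgW
    → FloorLg (Model.σ n s P w (s i) (i ∸ 1)) rs
    → (L : List ℕ) → Unique L → All (Model.Stubborn n s P w i) L
    → + length L ℤ.≤ + 1 ℤ.+ + 2 ℤ.* lgW ℤ.- + 2 ℤ.* rs
lemma4 n m s w P s-range w-pos greedy (suc t) _ i≤m lgW rs fW fsi L unique stubborn = begin
  + length L                            ≡⟨ cong (λ l → + length l) (items-positions stubborn) ⟨
  + length (map position as)            ≡⟨ cong +_ (length-map position as) ⟩
  + length as                           ≤⟨ ℤ.+≤+ (stubborn-count as (subst Unique (sym (items-positions stubborn)) unique)) ⟩
  + suc (2 ℕ.* height rs lgW)           ≡⟨ odd-bound lgW rs rs≤lgW ⟩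
  + 1 ℤ.+ + 2 ℤ.* lgW ℤ.- + 2 ℤ.* rs    ∎
  where
  open Intervals n m s w P s-range w-pos greedy t i≤m
  open Ranks lgW rs fW fsi
  open ℤP.≤-Reasoning
  as = items stubborn
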